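{- Let $n\ge1$, $t\ge0$ be integers and $S_{n,t}=\{w\in\widetilde{C}_n/C_n: w_n\le(2t+1)(n+1)\}$. Then $|S_{n,t}|=(2t+1)^n$.
   Context: Let $N=2n+2$. $\widetilde{C}_n/C_n$ denotes the set of windows of minimal length coset representatives of the affine hyperoctahedral group modulo the hyperoctahedral group; concretely it is the set of integer tuples $[w_1,\dots,w_n]$ with $0<w_1<\cdots<w_n$ such that the $2n$ integers $\pm w_1,\dots,\pm w_n$ are pairwise distinct modulo $N$. -}

module Defs where

open import Data.Nat using (ℕ; suc; _+_; _*_; _<_; _≤_; _%_)
open import Data.Fin using (Fin)
open import Data.Vec using (Vec; lookup; last)
open import Data.Product using (Σ; _×_)
open import Data.List using (List; length)
open import Data.List.Relation.Unary.Unique.Propositional using (Unique)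
open import Data.List.Membership.Propositional using (_∈_)
open import Relation.Binary.PropositionalEquality using (_≡_; _≢_)

-- N = 2n+2 (we index windows of length suc m, i.e. n = suc m ≥ 1)
modulus : ℕ → ℕ
modulus n = 2 * n + 2

-- [w₁,…,wₙ] (0-indexed via Fin n) is a window of a minimal length coset
-- representative of C̃ₙ/Cₙ: 0 < w₁ < ⋯ < wₙ and the 2n integers ±wᵢ are
-- pairwise distinct mod N.  Distinctness unfolds to:
--   wᵢ ≢ wⱼ (mod N) for i ≠ j   (covers +wᵢ vs +wⱼ and -wᵢ vs -wⱼ)
--   wᵢ ≢ -wⱼ (mod N) for all i, j, i.e. N ∤ wᵢ + wⱼ.
record IsWindow (n : ℕ) (w : Vec ℕ (suc n)) : Set where
  field
    positive   : ∀ i → 0 < lookup w i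
    increasing : ∀ (i j : Fin (suc n)) → Data.Fin._<_ i j → lookup w i < lookup w j
    distinct+  : ∀ (i j : Fin (suc n)) → i ≢ j →
                 (lookup w i % modulus (suc n)) ≢ (lookup w j % modulus (suc n))
    distinct±  : ∀ (i j : Fin (suc n)) →
                 ((lookup w i + lookup w j) % modulus (suc n)) ≢ 0

InS : ∀ m → ℕ → Vec ℕ (suc m) → Set
InS m t w = IsWindow m w × (last w ≤ (2 * t + 1) * (suc m + 1))

HasCard : ∀ {A : Set} → (A → Set) → ℕ → Set
HasCard {A} P k = Σ (List A) λ L →
  Unique L × (∀ x → (x ∈ L → P x) × (P x → x ∈ L)) × (length L ≡ k)

-- Put N = 2n + 2 and p = n + 1, and call the distance from v to the nearest
-- multiple of N the class of v.  Then v and -v (mod N) have the same class, and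
-- 2v ≢ 0 (mod N) exactly when the class of v lies in {1, …, n}.  Hence the
-- windows are exactly the increasing sequences whose n entries have pairwise
-- distinct classes in {1, …, n}, i.e. that contain exactly one number of each
-- class.  If the entries are bounded by B, such a sequence amounts to choosing,
-- for every class r, one of the numbers ≤ B of class r, so there are
-- ∏ᵣ #{v ≤ B : class v = r} of them.  For B = (2t + 1)(n + 1) = tN + p every
-- class r ∈ {1, …, n} occurs twice (as r and N - r) in each of the t full
-- periods and once (as r) in [0, p], that is 2t + 1 times.
module Submission where

open import Data.Fin as Fin using (fromℕ) renaming (zero to fzero; suc to fsuc)
import Data.Fin.Properties as Finₚ
open import Data.List using (List; []; _∷_; [_]; _++_; map; filter; length; applyUpTo; upTo)
open import Data.List.Membership.Propositional using (_∈_)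
open import Data.List.Membership.Propositional.Properties
  using (∈-filter⁺; ∈-filter⁻; ∈-map⁺; ∈-map⁻; ∈-++⁺ˡ; ∈-++⁺ʳ; ∈-++⁻;
         ∈-applyUpTo⁺; ∈-applyUpTo⁻; ∈-upTo⁺; ∈-upTo⁻)
open import Data.List.Properties
  using (filter-accept; filter-reject; filter-all; filter-++; length-++; length-map;
         map-cong-local; upTo-∷ʳ; length-applyUpTo)
open import Data.List.Relation.Binary.Permutation.Propositional
  using (_↭_; ↭-refl; ↭-reflexive; ↭-prep; ↭-swap; ↭-trans)
open import Data.List.Relation.Binary.Permutation.Propositional.Properties using (↭-length; map⁺)
open import Data.List.Relation.Binary.Subset.Propositional using (_⊆_)
open import Data.List.Relation.Unary.All as All using (All; []; _∷_)
open import Data.List.Relation.Unary.AllPairs using (AllPairs; []; _∷_)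
import Data.List.Relation.Unary.AllPairs.Properties as AllPairs
open import Data.List.Relation.Unary.Any using (here; there)
open import Data.List.Relation.Unary.Unique.Propositional using (Unique)
import Data.List.Relation.Unary.Unique.Propositional.Properties as Unique
open import Data.Nat
  using (ℕ; zero; suc; _+_; _*_; _^_; _<_; _≤_; _%_; _⊓_; _∸_; ⌊_/2⌋;
         s≤s; s≤s⁻¹; z<s; _≤?_; _<?_; _≟_)
open import Data.Nat.DivMod using (%-distribˡ-+; n%n≡0; [m+n]%n≡m%n; m%n<n; m<n⇒m%n≡m)
open import Data.Nat.ListAction using (product)
open import Data.Nat.ListAction.Properties using (product-↭)
open import Data.Nat.Properties
open import Data.Nat.Tactic.RingSolver using (solve-∀)
open import Data.Product using (_×_; _,_; proj₁; proj₂; map₁; uncurry)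
open import Data.Sum using (_⊎_; inj₁; inj₂; [_,_]′)
open import Data.Vec using (Vec; []; _∷_; lookup; last)
open import Data.Vec.Properties using (∷-injectiveʳ)
open import Function.Base using (_∘_; id)
open import Function.Bundles using (_⇔_; mk⇔; Equivalence)
open import Relation.Binary.Core using (Rel)
open import Relation.Binary.Definitions using (DecidableEquality; Transitive; Irreflexive)
open import Relation.Binary.PropositionalEquality
  using (_≡_; _≢_; refl; sym; trans; cong; cong₂; subst; module ≡-Reasoning)
open import Relation.Nullary using (yes; no; ¬_; ¬?; contradiction)

open import Defs using (modulus; IsWindow; InS; HasCard)

module Removal {A : Set} (_≟_ : DecidableEquality A) where

  -- Opaque, so that the arguments of xs ∖ x can be recovered by unification.
  opaque
    _∖_ : List A → A → List A
    xs ∖ x = filter (λ y → ¬? (y ≟ x)) xs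

    ∈-∖⁻ : ∀ {x y xs} → y ∈ xs ∖ x → y ∈ xs × y ≢ x
    ∈-∖⁻ = ∈-filter⁻ _

    ∈-∖⁺ : ∀ {x y xs} → y ∈ xs → y ≢ x → y ∈ xs ∖ x
    ∈-∖⁺ = ∈-filter⁺ _

    ∖-unique : ∀ {x xs} → Unique xs → Unique (xs ∖ x)
    ∖-unique = Unique.filter⁺ _

    ∖-↭ : ∀ {x xs} → Unique xs → x ∈ xs → xs ↭ x ∷ xs ∖ x
    ∖-↭ {x} {y ∷ xs} (y∉xs ∷ xs!) x∈y∷xs with y ≟ x
    ... | yes refl =
      ↭-prep y (↭-reflexive (sym (filter-all _ (All.map (λ y≢z z≡y → y≢z (sym z≡y)) y∉xs))))
    ... | no y≢x with x∈y∷xs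
    ...   | here x≡y   = contradiction (sym x≡y) y≢x
    ...   | there x∈xs = ↭-trans (↭-prep y (∖-↭ xs! x∈xs)) (↭-swap y x ↭-refl)

  unique-⊆⊇⇒↭ : ∀ {xs ys} → Unique xs → Unique ys → xs ⊆ ys → ys ⊆ xs → xs ↭ ys
  unique-⊆⊇⇒↭ {[]}    {[]}     _ _ _   _ = ↭-refl
  unique-⊆⊇⇒↭ {_ ∷ _} {[]}     _ _ xs⊆ _ with () ← xs⊆ (here refl)
  unique-⊆⊇⇒↭ {xs}    {y ∷ ys} xs! (y∉ys ∷ ys!) xs⊆ ys⊆ =
    ↭-trans (∖-↭ xs! (ys⊆ (here refl))) (↭-prep y (unique-⊆⊇⇒↭ (∖-unique xs!) ys! sub sup))
    where
    sub : xs ∖ y ⊆ ys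
    sub z∈ with z∈xs , z≢y ← ∈-∖⁻ z∈ with xs⊆ z∈xs
    ... | here z≡y   = contradiction z≡y z≢y
    ... | there z∈ys = z∈ys
    sup : ys ⊆ xs ∖ y
    sup z∈ys = ∈-∖⁺ (ys⊆ (there z∈ys)) (λ z≡y → All.lookup y∉ys z∈ys (sym z≡y))

Increasing : ∀ {A : Set} {ℓ k} → Rel A ℓ → Vec A k → Set ℓ
Increasing _≺_ xs = ∀ i j → i Fin.< j → lookup xs i ≺ lookup xs j

last≡lookup-fromℕ : ∀ {A : Set} {k} (xs : Vec A (suc k)) → last xs ≡ lookup xs (fromℕ k)
last≡lookup-fromℕ (x ∷ [])     = refl
last≡lookup-fromℕ (x ∷ y ∷ xs) = last≡lookup-fromℕ (y ∷ xs)

lookup≤last : ∀ {k} {xs : Vec ℕ (suc k)} → Increasing _<_ xs → ∀ i → lookup xs i ≤ last xs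
lookup≤last {k} {xs} inc i rewrite last≡lookup-fromℕ xs with i Fin.≟ fromℕ k
... | yes refl = ≤-refl
... | no  i≢k  = <⇒≤ (inc i (fromℕ k) (Finₚ.≤∧≢⇒< (Finₚ.≤fromℕ i) i≢k))

module Subsequence {A : Set} where

  data _⊑_ : ∀ {k} → Vec A k → List A → Set where
    []   : ∀ {ys} → [] ⊑ ys
    keep : ∀ {k y ys} {xs : Vec A k} → xs ⊑ ys → (y ∷ xs) ⊑ (y ∷ ys)
    skip : ∀ {k y ys} {xs : Vec A k} → xs ⊑ ys → xs ⊑ (y ∷ ys)

  ⊑⇒∈ : ∀ {k ys} {xs : Vec A k} → xs ⊑ ys → ∀ i → lookup xs i ∈ ys
  ⊑⇒∈ (keep xs⊑) fzero    = here refl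
  ⊑⇒∈ (keep xs⊑) (fsuc i) = there (⊑⇒∈ xs⊑ i)
  ⊑⇒∈ (skip xs⊑) i        = there (⊑⇒∈ xs⊑ i)

  module _ {ℓ} {_≺_ : Rel A ℓ} where

    increasing-tail : ∀ {k x} {xs : Vec A k} → Increasing _≺_ (x ∷ xs) → Increasing _≺_ xs
    increasing-tail inc i j i<j = inc (fsuc i) (fsuc j) (s≤s i<j)

    ⊑-sorted⇒increasing : ∀ {k ys} {xs : Vec A k} →
                          AllPairs _≺_ ys → xs ⊑ ys → Increasing _≺_ xs
    ⊑-sorted⇒increasing (_ ∷ ys↗) (skip xs⊑) = ⊑-sorted⇒increasing ys↗ xs⊑
    ⊑-sorted⇒increasing (y≺ys ∷ _) (keep xs⊑) fzero (fsuc j) _ =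
      All.lookup y≺ys (⊑⇒∈ xs⊑ j)
    ⊑-sorted⇒increasing (_ ∷ ys↗) (keep xs⊑) (fsuc i) (fsuc j) (s≤s i<j) =
      ⊑-sorted⇒increasing ys↗ xs⊑ i j i<j

    module _ (≺-trans : Transitive _≺_) (≺-irrefl : Irreflexive _≡_ _≺_) where

      private
        ∈-behind : ∀ {y z ys} → y ≺ z → z ∈ y ∷ ys → z ∈ ys
        ∈-behind y≺z (here z≡y)   = contradiction y≺z (≺-irrefl (sym z≡y))
        ∈-behind y≺z (there z∈ys) = z∈ys

      increasing⇒⊑ : ∀ {k ys} {xs : Vec A k} → AllPairs _≺_ ys → Increasing _≺_ xs →
                     (∀ i → lookup xs i ∈ ys) → xs ⊑ ys
      increasing⇒⊑ {xs = []} _ _ _ = []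
      increasing⇒⊑ {ys = []} {xs = _ ∷ _} _ _ xs⊆ with () ← xs⊆ fzero
      increasing⇒⊑ {ys = y ∷ ys} {xs = x ∷ xs} (y≺ys ∷ ys↗) inc xs⊆ with xs⊆ fzero
      ... | here refl  = keep (increasing⇒⊑ ys↗ (increasing-tail inc)
                                (λ i → ∈-behind (inc fzero (fsuc i) z<s) (xs⊆ (fsuc i))))
      ... | there x∈ys = skip (increasing⇒⊑ ys↗ inc x∷xs⊆ys)
        where
        x∷xs⊆ys : ∀ i → lookup (x ∷ xs) i ∈ ys
        x∷xs⊆ys fzero    = x∈ys
        x∷xs⊆ys (fsuc i) =
          ∈-behind (≺-trans (All.lookup y≺ys x∈ys) (inc fzero (fsuc i) z<s)) (xs⊆ (fsuc i))

module Rainbow {A C : Set} (_≟_ : DecidableEquality C) (colour : A → C) where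

  open Removal _≟_
  open Subsequence
  open import Data.List.Membership.DecPropositional _≟_ using (_∈?_)

  count : C → List A → ℕ
  count c xs = length (filter (λ x → colour x ≟ c) xs)

  count-++ : ∀ c xs ys → count c (xs ++ ys) ≡ count c xs + count c ys
  count-++ c xs ys = trans (cong length (filter-++ _ xs ys)) (length-++ (filter _ xs))

  count-∷-colour : ∀ x xs → count (colour x) (x ∷ xs) ≡ suc (count (colour x) xs)
  count-∷-colour x xs = cong length (filter-accept (λ y → colour y ≟ colour x) refl)

  count-∷-other : ∀ {c} x xs → colour x ≢ c → count c (x ∷ xs) ≡ count c xs
  count-∷-other x xs x≢c = cong length (filter-reject (λ y → colour y ≟ _) x≢c)

  count-[-]-cong : ∀ {c} x y → colour x ≡ colour y → count c [ x ] ≡ count c [ y ]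
  count-[-]-cong {c} x y x≡y with colour x ≟ c | colour y ≟ c
  ... | yes _   | yes _   = refl
  ... | no  _   | no  _   = refl
  ... | yes x≡c | no  y≢c = contradiction (trans (sym x≡y) x≡c) y≢c
  ... | no  x≢c | yes y≡c = contradiction (trans x≡y y≡c) x≢c

  Rainbow : ∀ {k} → List C → Vec A k → Set
  Rainbow cs xs = (∀ i → colour (lookup xs i) ∈ cs) ×
                  (∀ i j → i ≢ j → colour (lookup xs i) ≢ colour (lookup xs j))

  rainbow-∷⁺ : ∀ {k cs x} {xs : Vec A k} →
               colour x ∈ cs → Rainbow (cs ∖ colour x) xs → Rainbow cs (x ∷ xs)
  rainbow-∷⁺ {cs = cs} {x} {xs} x∈cs (xs⊆ , xs-distinct) = x∷xs⊆ , x∷xs-distinct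
    where
    x∷xs⊆ : ∀ i → colour (lookup (x ∷ xs) i) ∈ cs
    x∷xs⊆ fzero    = x∈cs
    x∷xs⊆ (fsuc i) = proj₁ (∈-∖⁻ (xs⊆ i))
    x∷xs-distinct : ∀ i j → i ≢ j → colour (lookup (x ∷ xs) i) ≢ colour (lookup (x ∷ xs) j)
    x∷xs-distinct fzero    fzero    i≢j = contradiction refl i≢j
    x∷xs-distinct fzero    (fsuc j) _   = proj₂ (∈-∖⁻ (xs⊆ j)) ∘ sym
    x∷xs-distinct (fsuc i) fzero    _   = proj₂ (∈-∖⁻ (xs⊆ i))
    x∷xs-distinct (fsuc i) (fsuc j) i≢j = xs-distinct i j (i≢j ∘ cong fsuc)

  rainbow-∷⁻ : ∀ {k cs x} {xs : Vec A k} →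
               Rainbow cs (x ∷ xs) → colour x ∈ cs × Rainbow (cs ∖ colour x) xs
  rainbow-∷⁻ (x∷xs⊆ , distinct) =
    x∷xs⊆ fzero ,
    (λ i → ∈-∖⁺ (x∷xs⊆ (fsuc i)) (distinct (fsuc i) fzero λ ())) ,
    (λ i j i≢j → distinct (fsuc i) (fsuc j) (i≢j ∘ Finₚ.suc-injective))

  rainbows : (k : ℕ) → List C → List A → List (Vec A k)
  rainbows zero    cs _        = [ [] ]
  rainbows (suc k) cs []       = []
  rainbows (suc k) cs (y ∷ ys) with colour y ∈? cs
  ... | yes _ = map (y ∷_) (rainbows k (cs ∖ colour y) ys) ++ rainbows (suc k) cs ys
  ... | no  _ = rainbows (suc k) cs ys

  ∈-rainbows⁻ : ∀ k cs ys {xs : Vec A k} → xs ∈ rainbows k cs ys → xs ⊑ ys × Rainbow cs xs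
  ∈-rainbows⁻ zero cs ys {[]} _ = [] , (λ ()) , (λ ())
  ∈-rainbows⁻ (suc k) cs (y ∷ ys) xs∈ with colour y ∈? cs
  ... | no _ = map₁ skip (∈-rainbows⁻ (suc k) cs ys xs∈)
  ... | yes y∈cs with ∈-++⁻ (map (y ∷_) (rainbows k (cs ∖ colour y) ys)) xs∈
  ...   | inj₂ xs∈′ = map₁ skip (∈-rainbows⁻ (suc k) cs ys xs∈′)
  ...   | inj₁ xs∈′ with _ , xs′∈ , refl ← ∈-map⁻ (y ∷_) xs∈′
                    with xs′⊑ , rainbow ← ∈-rainbows⁻ k (cs ∖ colour y) ys xs′∈
                    = keep xs′⊑ , rainbow-∷⁺ y∈cs rainbow

  ∈-rainbows⁺ : ∀ k cs ys {xs : Vec A k} → xs ⊑ ys → Rainbow cs xs → xs ∈ rainbows k cs ys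
  ∈-rainbows⁺ zero    cs ys       {[]} _ _ = here refl
  ∈-rainbows⁺ (suc k) cs []       () _
  ∈-rainbows⁺ (suc k) cs (y ∷ ys) (skip xs⊑) rainbow with colour y ∈? cs
  ... | yes _ = ∈-++⁺ʳ (map (y ∷_) (rainbows k (cs ∖ colour y) ys))
                       (∈-rainbows⁺ (suc k) cs ys xs⊑ rainbow)
  ... | no  _ = ∈-rainbows⁺ (suc k) cs ys xs⊑ rainbow
  ∈-rainbows⁺ (suc k) cs (y ∷ ys) (keep xs⊑) rainbow with colour y ∈? cs | rainbow-∷⁻ rainbow
  ... | yes _   | _ , rainbow′ =
    ∈-++⁺ˡ (∈-map⁺ (y ∷_) (∈-rainbows⁺ k (cs ∖ colour y) ys xs⊑ rainbow′))
  ... | no y∉cs | y∈cs , _     = contradiction y∈cs y∉cs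

  rainbows-unique : ∀ k cs {ys} → Unique ys → Unique (rainbows k cs ys)
  rainbows-unique zero    cs _ = [] ∷ []
  rainbows-unique (suc k) cs {[]} _ = []
  rainbows-unique (suc k) cs {y ∷ ys} (y∉ys ∷ ys!) with colour y ∈? cs
  ... | no  _ = rainbows-unique (suc k) cs ys!
  ... | yes _ = Unique.++⁺ (Unique.map⁺ ∷-injectiveʳ (rainbows-unique k (cs ∖ colour y) ys!))
                           (rainbows-unique (suc k) cs ys!) disjoint
    where
    disjoint : ∀ {xs} →
               ¬ (xs ∈ map (y ∷_) (rainbows k (cs ∖ colour y) ys) × xs ∈ rainbows (suc k) cs ys)
    disjoint (xs∈ , xs∈′) with _ , _ , refl ← ∈-map⁻ (y ∷_) xs∈ =
      All.lookup y∉ys (⊑⇒∈ (proj₁ (∈-rainbows⁻ (suc k) cs ys xs∈′)) fzero) refl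

  length-rainbows : ∀ k {cs} ys → Unique cs → length cs ≡ k →
                    length (rainbows k cs ys) ≡ product (map (λ c → count c ys) cs)
  length-rainbows zero    {[]}    _  _ _ = refl
  length-rainbows (suc k) {_ ∷ _} [] _ _ = refl
  length-rainbows (suc k) {cs} (y ∷ ys) cs! |cs| with colour y ∈? cs
  ... | no y∉cs = trans (length-rainbows (suc k) ys cs! |cs|) (cong product (map-cong-local
                    (All.tabulate λ c∈cs →
                      sym (count-∷-other y ys λ y≡c → y∉cs (subst (_∈ cs) (sym y≡c) c∈cs)))))
  ... | yes y∈cs = begin
      length (map (y ∷_) (rainbows k rest ys) ++ rainbows (suc k) cs ys)
        ≡⟨ length-++ (map (y ∷_) (rainbows k rest ys)) ⟩
      length (map (y ∷_) (rainbows k rest ys)) + length (rainbows (suc k) cs ys)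
        ≡⟨ cong₂ _+_ (trans (length-map (y ∷_) (rainbows k rest ys))
                            (length-rainbows k ys (∖-unique cs!) |rest|))
                     (length-rainbows (suc k) ys cs! |cs|) ⟩
      Π ys rest + Π ys cs
        ≡⟨ cong (Π ys rest +_) (product-↭ (map⁺ (λ c → count c ys) cs↭)) ⟩
      suc (count (colour y) ys) * Π ys rest
        ≡⟨ cong₂ _*_ (sym (count-∷-colour y ys)) (cong product (map-cong-local
             (All.tabulate λ c∈rest → sym (count-∷-other y ys λ y≡c → proj₂ (∈-∖⁻ c∈rest) (sym y≡c))))) ⟩
      Π (y ∷ ys) (colour y ∷ rest)
        ≡⟨ sym (product-↭ (map⁺ (λ c → count c (y ∷ ys)) cs↭)) ⟩
      Π (y ∷ ys) cs ∎
    where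
    open ≡-Reasoning
    Π : List A → List C → ℕ
    Π zs ds = product (map (λ c → count c zs) ds)
    rest : List C
    rest = cs ∖ colour y
    cs↭ : cs ↭ colour y ∷ rest
    cs↭ = ∖-↭ cs! y∈cs
    |rest| : length rest ≡ k
    |rest| = suc-injective (trans (sym (↭-length cs↭)) |cs|)

product-map-≡ : ∀ {A : Set} {f : A → ℕ} {k} xs →
                All (λ x → f x ≡ k) xs → product (map f xs) ≡ k ^ length xs
product-map-≡ []       []             = refl
product-map-≡ (x ∷ xs) (fx≡k ∷ fxs≡k) = cong₂ _*_ fx≡k (product-map-≡ xs fxs≡k)

upTo-sorted : ∀ b → AllPairs _<_ (upTo b)
upTo-sorted b = AllPairs.applyUpTo⁺₁ id b (λ i<j _ → i<j)

m+m≡n+n⇒m≡n : ∀ {m n} → m + m ≡ n + n → m ≡ n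
m+m≡n+n⇒m≡n {m} {n} eq = trans (n≡⌊n+n/2⌋ m) (trans (cong ⌊_/2⌋ eq) (sym (n≡⌊n+n/2⌋ n)))

2n+2≡[1+n]+[1+n] : ∀ n → 2 * n + 2 ≡ suc n + suc n
2n+2≡[1+n]+[1+n] = solve-∀

module Classes (m : ℕ) where

  n p N : ℕ
  n = suc m
  p = suc n
  N = modulus n

  N≡p+p : N ≡ p + p
  N≡p+p = 2n+2≡[1+n]+[1+n] n

  p<N : p < N
  p<N = subst (p <_) (sym N≡p+p) (m<m+n p z<s)

  fold : ℕ → ℕ
  fold x = x ⊓ (N ∸ x)

  class : ℕ → ℕ
  class v = fold (v % N)

  fold-∸ : ∀ {x} → x ≤ N → fold (N ∸ x) ≡ fold x
  fold-∸ {x} x≤N = trans (cong ((N ∸ x) ⊓_) (m∸[m∸n]≡n x≤N)) (⊓-comm (N ∸ x) x)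

  fold-small : ∀ {x} → x + x ≤ N → fold x ≡ x
  fold-small {x} x+x≤N = m≤n⇒m⊓n≡m (m+n≤o⇒m≤o∸n x x+x≤N)

  fold-p : fold p ≡ p
  fold-p = fold-small (≤-reflexive (sym N≡p+p))

  fold≤p : ∀ x → fold x ≤ p
  fold≤p x with x ≤? p
  ... | yes x≤p = ≤-trans (m⊓n≤m x (N ∸ x)) x≤p
  ... | no  x≰p = ≤-trans (m⊓n≤n x (N ∸ x)) (≤-trans (∸-monoʳ-≤ N (≰⇒≥ x≰p)) (≤-reflexive N∸p≡p))
    where
    N∸p≡p : N ∸ p ≡ p
    N∸p≡p = trans (cong (_∸ p) N≡p+p) (m+n∸n≡m p p)

  fold-injective± : ∀ {x y} → x < N → y < N → fold x ≡ fold y → x ≡ y ⊎ x + y ≡ N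
  fold-injective± {x} {y} x<N y<N eq with ⊓-sel x (N ∸ x) | ⊓-sel y (N ∸ y)
  ... | inj₁ fx≡x   | inj₁ fy≡y   = inj₁ (trans (sym fx≡x) (trans eq fy≡y))
  ... | inj₂ fx≡N∸x | inj₂ fy≡N∸y =
    inj₁ (∸-cancelˡ-≡ (<⇒≤ x<N) (<⇒≤ y<N) (trans (sym fx≡N∸x) (trans eq fy≡N∸y)))
  ... | inj₁ fx≡x   | inj₂ fy≡N∸y =
    inj₂ (trans (cong (_+ y) (trans (sym fx≡x) (trans eq fy≡N∸y))) (m∸n+n≡m (<⇒≤ y<N)))
  ... | inj₂ fx≡N∸x | inj₁ fy≡y   =
    inj₂ (trans (cong (x +_) (trans (sym fy≡y) (trans (sym eq) fx≡N∸x))) (m+[n∸m]≡n (<⇒≤ x<N)))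

  %N≡0⇒ : ∀ {z} → z < N + N → z % N ≡ 0 → z ≡ 0 ⊎ z ≡ N
  %N≡0⇒ {z} z<N+N z%N≡0 with z <? N
  ... | yes z<N = inj₁ (trans (sym (m<n⇒m%n≡m z<N)) z%N≡0)
  ... | no  z≮N = inj₂ (trans (sym (m∸n+n≡m N≤z)) (cong (_+ N) z∸N≡0))
    where
    open ≡-Reasoning
    N≤z : N ≤ z
    N≤z = ≮⇒≥ z≮N
    z∸N≡0 : z ∸ N ≡ 0
    z∸N≡0 = begin
      z ∸ N           ≡⟨ m<n⇒m%n≡m (m<n+o⇒m∸n<o z N z<N+N) ⟨
      (z ∸ N) % N     ≡⟨ [m+n]%n≡m%n (z ∸ N) N ⟨
      (z ∸ N + N) % N ≡⟨ cong (_% N) (m∸n+n≡m N≤z) ⟩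
      z % N           ≡⟨ z%N≡0 ⟩
      0               ∎

  +%N≡0⇒ : ∀ a b → (a + b) % N ≡ 0 → a % N + b % N ≡ 0 ⊎ a % N + b % N ≡ N
  +%N≡0⇒ a b eq = %N≡0⇒ (+-mono-< (m%n<n a N) (m%n<n b N)) (trans (sym (%-distribˡ-+ a b N)) eq)

  class-≡⇒ : ∀ a b → class a ≡ class b → a % N ≡ b % N ⊎ (a + b) % N ≡ 0
  class-≡⇒ a b eq with fold-injective± (m%n<n a N) (m%n<n b N) eq
  ... | inj₁ a≡b   = inj₁ a≡b
  ... | inj₂ sum≡N = inj₂ (trans (%-distribˡ-+ a b N) (trans (cong (_% N) sum≡N) (n%n≡0 N)))

  class-≡⇐ : ∀ a b → (a + b) % N ≡ 0 → class a ≡ class b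
  class-≡⇐ a b eq with +%N≡0⇒ a b eq
  ... | inj₁ sum≡0 = cong fold (trans (m+n≡0⇒m≡0 (a % N) sum≡0) (sym (m+n≡0⇒n≡0 (a % N) sum≡0)))
  ... | inj₂ sum≡N = begin
      fold (a % N)                 ≡⟨ fold-∸ (<⇒≤ (m%n<n a N)) ⟨
      fold (N ∸ a % N)             ≡⟨ cong (λ z → fold (z ∸ a % N)) sum≡N ⟨
      fold (a % N + b % N ∸ a % N) ≡⟨ cong fold (m+n∸m≡n (a % N) (b % N)) ⟩
      fold (b % N)                 ∎
    where open ≡-Reasoning

  class-+N : ∀ v → class (v + N) ≡ class v
  class-+N v = cong fold ([m+n]%n≡m%n v N)

  class-below : ∀ {z} → z < N → class z ≡ fold z
  class-below z<N = cong fold (m<n⇒m%n≡m z<N)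

  class≡0⇒ : ∀ v → class v ≡ 0 → v % N ≡ 0
  class≡0⇒ v eq with fold-injective± {y = 0} (m%n<n v N) (m<m+n 0 {N} z<s) eq
  ... | inj₁ x≡0   = x≡0
  ... | inj₂ x+0≡N = contradiction (trans (sym (+-identityʳ _)) x+0≡N) (<⇒≢ (m%n<n v N))

  class≡p⇒ : ∀ v → class v ≡ p → v % N ≡ p
  class≡p⇒ v eq with fold-injective± (m%n<n v N) p<N (trans eq (sym fold-p))
  ... | inj₁ x≡p   = x≡p
  ... | inj₂ x+p≡N = +-cancelʳ-≡ _ _ _ (trans x+p≡N N≡p+p)

  classes : List ℕ
  classes = applyUpTo suc n

  ∈-classes⁺ : ∀ {c} → 0 < c → c < p → c ∈ classes
  ∈-classes⁺ {suc i} _ (s≤s i<n) = ∈-applyUpTo⁺ suc i<n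

  ∈-classes⁻ : ∀ {c} → c ∈ classes → 0 < c × c < p
  ∈-classes⁻ c∈ with _ , i<n , refl ← ∈-applyUpTo⁻ suc c∈ = z<s , s≤s i<n

  class∈classes⇔ : ∀ v → class v ∈ classes ⇔ (v + v) % N ≢ 0
  class∈classes⇔ v = mk⇔ to from
    where
    v+v≡0 : ∀ {x} → v % N ≡ x → (x + x) % N ≡ 0 → (v + v) % N ≡ 0
    v+v≡0 v≡x x+x≡0 = trans (%-distribˡ-+ v v N) (trans (cong (λ z → (z + z) % N) v≡x) x+x≡0)
    p+p≡0 : (p + p) % N ≡ 0
    p+p≡0 = trans (cong (_% N) (sym N≡p+p)) (n%n≡0 N)
    to : class v ∈ classes → (v + v) % N ≢ 0
    to c∈ v+v≡0 with 0<c , c<p ← ∈-classes⁻ c∈ with +%N≡0⇒ v v v+v≡0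
    ... | inj₁ x+x≡0 = <⇒≢ 0<c (sym (cong fold (m+n≡0⇒m≡0 (v % N) x+x≡0)))
    ... | inj₂ x+x≡N = <⇒≢ c<p (trans (cong fold (m+m≡n+n⇒m≡n (trans x+x≡N N≡p+p))) fold-p)
    from : (v + v) % N ≢ 0 → class v ∈ classes
    from v+v≢0 = ∈-classes⁺ (n≢0⇒n>0 (λ c≡0 → v+v≢0 (v+v≡0 (class≡0⇒ v c≡0) refl)))
                            (≤∧≢⇒< (fold≤p (v % N)) (λ c≡p → v+v≢0 (v+v≡0 (class≡p⇒ v c≡p) p+p≡0)))

  open Removal _≟_ using (unique-⊆⊇⇒↭)
  open Rainbow _≟_ class using (count; count-++; count-[-]-cong)

  count-upTo-suc : ∀ r b → count r (upTo (suc b)) ≡ count r (upTo b) + count r [ b ]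
  count-upTo-suc r b = trans (cong (count r) (sym (upTo-∷ʳ b))) (count-++ r (upTo b) [ b ])

  count-upTo-+N : ∀ r b → count r (upTo (b + N)) ≡ count r (upTo N) + count r (upTo b)
  count-upTo-+N r zero    = sym (+-identityʳ _)
  count-upTo-+N r (suc b) = begin
    count r (upTo (suc (b + N)))
      ≡⟨ count-upTo-suc r (b + N) ⟩
    count r (upTo (b + N)) + count r [ b + N ]
      ≡⟨ cong₂ _+_ (count-upTo-+N r b) (count-[-]-cong (b + N) b (class-+N b)) ⟩
    count r (upTo N) + count r (upTo b) + count r [ b ]
      ≡⟨ +-assoc (count r (upTo N)) _ _ ⟩
    count r (upTo N) + (count r (upTo b) + count r [ b ])
      ≡⟨ cong (count r (upTo N) +_) (count-upTo-suc r b) ⟨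
    count r (upTo N) + count r (upTo (suc b)) ∎
    where open ≡-Reasoning

  count-upTo-periodic : ∀ r t q → count r (upTo (t * N + q)) ≡ t * count r (upTo N) + count r (upTo q)
  count-upTo-periodic r zero    q = refl
  count-upTo-periodic r (suc t) q = begin
    count r (upTo (N + t * N + q))
      ≡⟨ cong (count r ∘ upTo) (trans (+-assoc N (t * N) q) (+-comm N _)) ⟩
    count r (upTo (t * N + q + N))
      ≡⟨ count-upTo-+N r (t * N + q) ⟩
    count r (upTo N) + count r (upTo (t * N + q))
      ≡⟨ cong (count r (upTo N) +_) (count-upTo-periodic r t q) ⟩
    count r (upTo N) + (t * count r (upTo N) + count r (upTo q))
      ≡⟨ +-assoc (count r (upTo N)) _ _ ⟨
    suc t * count r (upTo N) + count r (upTo q) ∎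
    where open ≡-Reasoning

  module _ {r} (r∈classes : r ∈ classes) where

    private
      0<r : 0 < r
      0<r = proj₁ (∈-classes⁻ r∈classes)
      r<p : r < p
      r<p = proj₂ (∈-classes⁻ r∈classes)
      r<N : r < N
      r<N = <-trans r<p p<N
      r+r<N : r + r < N
      r+r<N = subst (r + r <_) (sym N≡p+p) (+-mono-< r<p r<p)
      N∸r<N : N ∸ r < N
      N∸r<N = ∸-monoʳ-< 0<r (<⇒≤ r<N)
      fold-r : fold r ≡ r
      fold-r = fold-small (<⇒≤ r+r<N)

      of-class-r : ℕ → List ℕ
      of-class-r b = filter (λ z → class z ≟ r) (upTo b)

      of-class-r-unique : ∀ b → Unique (of-class-r b)
      of-class-r-unique b = Unique.filter⁺ _ (Unique.upTo⁺ b)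

      ∈-of-class-r⁻ : ∀ {b z} → z ∈ of-class-r b → z < b × class z ≡ r
      ∈-of-class-r⁻ z∈ = map₁ ∈-upTo⁻ (∈-filter⁻ (λ z → class z ≟ r) z∈)

      ∈-of-class-r⁺ : ∀ {b z} → z < b → class z ≡ r → z ∈ of-class-r b
      ∈-of-class-r⁺ z<b = ∈-filter⁺ (λ z → class z ≟ r) (∈-upTo⁺ z<b)

    class-r : class r ≡ r
    class-r = trans (class-below r<N) fold-r

    class-N∸r : class (N ∸ r) ≡ r
    class-N∸r = trans (class-below N∸r<N) (trans (fold-∸ (<⇒≤ r<N)) fold-r)

    class≡r⇒ : ∀ {z} → z < N → class z ≡ r → z ≡ r ⊎ z + r ≡ N
    class≡r⇒ z<N eq = fold-injective± z<N r<N (trans (sym (class-below z<N)) (trans eq (sym fold-r)))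

    count-upTo-N : count r (upTo N) ≡ 2
    count-upTo-N = ↭-length (unique-⊆⊇⇒↭ (of-class-r-unique N) r,N∸r-unique sub sup)
      where
      r≢N∸r : r ≢ N ∸ r
      r≢N∸r r≡N∸r = <⇒≢ r+r<N (trans (cong (r +_) r≡N∸r) (m+[n∸m]≡n (<⇒≤ r<N)))
      r,N∸r-unique : Unique (r ∷ N ∸ r ∷ [])
      r,N∸r-unique = (r≢N∸r ∷ []) ∷ [] ∷ []
      sub : of-class-r N ⊆ r ∷ N ∸ r ∷ []
      sub z∈ with z<N , class≡r ← ∈-of-class-r⁻ z∈ with class≡r⇒ z<N class≡r
      ... | inj₁ z≡r   = here z≡r
      ... | inj₂ z+r≡N = there (here (trans (sym (m+n∸n≡m _ r)) (cong (_∸ r) z+r≡N)))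
      sup : r ∷ N ∸ r ∷ [] ⊆ of-class-r N
      sup (here refl)         = ∈-of-class-r⁺ r<N class-r
      sup (there (here refl)) = ∈-of-class-r⁺ N∸r<N class-N∸r

    count-upTo-1+p : count r (upTo (suc p)) ≡ 1
    count-upTo-1+p = ↭-length (unique-⊆⊇⇒↭ (of-class-r-unique (suc p)) ([] ∷ []) sub sup)
      where
      sub : of-class-r (suc p) ⊆ r ∷ []
      sub z∈ with z<1+p , class≡r ← ∈-of-class-r⁻ z∈ with class≡r⇒ (≤-<-trans (s≤s⁻¹ z<1+p) p<N) class≡r
      ... | inj₁ z≡r   = here z≡r
      ... | inj₂ z+r≡N = contradiction (trans z+r≡N N≡p+p) (<⇒≢ (+-mono-≤-< (s≤s⁻¹ z<1+p) r<p))
      sup : r ∷ [] ⊆ of-class-r (suc p)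
      sup (here refl) = ∈-of-class-r⁺ (<-trans r<p (n<1+n p)) class-r

bound≡ : ∀ m t → suc ((2 * t + 1) * (suc m + 1)) ≡ t * (2 * suc m + 2) + suc (suc (suc m))
bound≡ = solve-∀

module Windows (m t : ℕ) where

  open Classes m public
  open Subsequence public
  open Rainbow _≟_ class public

  B : ℕ
  B = (2 * t + 1) * (suc m + 1)

  candidates : List ℕ
  candidates = upTo (suc B)

  windows : List (Vec ℕ n)
  windows = rainbows n classes candidates

  window⇒rainbow : ∀ {w} → InS m t w → w ⊑ candidates × Rainbow classes w
  window⇒rainbow {w} (window , last≤B) = w⊑ , w-classes , w-distinct
    where
    open IsWindow window
    w⊑ : w ⊑ candidates
    w⊑ = increasing⇒⊑ <-trans <-irrefl (upTo-sorted (suc B)) increasing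
           (λ i → ∈-upTo⁺ (s≤s (≤-trans (lookup≤last increasing i) last≤B)))
    w-classes : ∀ i → class (lookup w i) ∈ classes
    w-classes i = Equivalence.from (class∈classes⇔ (lookup w i)) (distinct± i i)
    w-distinct : ∀ i j → i ≢ j → class (lookup w i) ≢ class (lookup w j)
    w-distinct i j i≢j = [ distinct+ i j i≢j , distinct± i j ]′ ∘ class-≡⇒ (lookup w i) (lookup w j)

  rainbow⇒window : ∀ {w} → w ⊑ candidates × Rainbow classes w → InS m t w
  rainbow⇒window {w} (w⊑ , w-classes , w-distinct) = window , last≤B
    where
    admissible : ∀ i → (lookup w i + lookup w i) % N ≢ 0
    admissible i = Equivalence.to (class∈classes⇔ (lookup w i)) (w-classes i)
    distinct± : ∀ i j → (lookup w i + lookup w j) % N ≢ 0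
    distinct± i j with i Fin.≟ j
    ... | yes refl = admissible i
    ... | no  i≢j  = w-distinct i j i≢j ∘ class-≡⇐ (lookup w i) (lookup w j)
    window : IsWindow m w
    window = record
      { positive   = λ i → n≢0⇒n>0 λ wᵢ≡0 → admissible i (subst (λ z → (z + z) % N ≡ 0) (sym wᵢ≡0) refl)
      ; increasing = ⊑-sorted⇒increasing (upTo-sorted (suc B)) w⊑
      ; distinct+  = λ i j i≢j → w-distinct i j i≢j ∘ cong fold
      ; distinct±  = distinct±
      }
    last≤B : last w ≤ B
    last≤B = s≤s⁻¹ (∈-upTo⁻ (subst (_∈ candidates) (sym (last≡lookup-fromℕ w)) (⊑⇒∈ w⊑ (fromℕ m))))

  count-candidates : ∀ {r} → r ∈ classes → count r candidates ≡ 2 * t + 1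
  count-candidates {r} r∈classes = begin
    count r (upTo (suc B))
      ≡⟨ cong (count r ∘ upTo) (bound≡ m t) ⟩
    count r (upTo (t * N + suc p))
      ≡⟨ count-upTo-periodic r t (suc p) ⟩
    t * count r (upTo N) + count r (upTo (suc p))
      ≡⟨ cong₂ (λ a b → t * a + b) (count-upTo-N r∈classes) (count-upTo-1+p r∈classes) ⟩
    t * 2 + 1
      ≡⟨ cong (_+ 1) (*-comm t 2) ⟩
    2 * t + 1 ∎
    where open ≡-Reasoning

mainTheorem7 : ∀ (m t : ℕ) → HasCard (InS m t) ((2 * t + 1) ^ suc m)
mainTheorem7 m t =
  windows ,
  rainbows-unique n classes (Unique.upTo⁺ (suc B)) ,
  (λ w → rainbow⇒window ∘ ∈-rainbows⁻ n classes candidates ,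
         uncurry (∈-rainbows⁺ n classes candidates) ∘ window⇒rainbow) ,
  (begin
    length windows                                   ≡⟨ length-rainbows n candidates classes-unique |classes| ⟩
    product (map (λ c → count c candidates) classes) ≡⟨ product-map-≡ classes (All.tabulate count-candidates) ⟩
    (2 * t + 1) ^ length classes                     ≡⟨ cong ((2 * t + 1) ^_) |classes| ⟩
    (2 * t + 1) ^ n                                  ∎)
  where
  open Windows m t
  open ≡-Reasoning
  classes-unique : Unique classes
  classes-unique = Unique.applyUpTo⁺₁ suc n (λ i<j _ → <⇒≢ (s≤s i<j))
  |classes| : length classes ≡ n
  |classes| = length-applyUpTo suc n
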